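{- Let $0\le\alpha\le1$. Let $G$ be a digraph and let $u,v$ be two internal vertices of an internal directed path of $G$, and let $H$ be a digraph with a vertex $w$. Let $Gu{:}wH$ (resp. $Gv{:}wH$) denote the digraph obtained from disjoint copies of $G$ and $H$ by identifying $u$ (resp. $v$) with $w$. Then $\phi_\alpha(Gu{:}wH)=\phi_\alpha(Gv{:}wH)$.
   Context: Digraphs are finite and simple. $A_\alpha(G)=\alpha D(G)+(1-\alpha)A(G)$ with $A(G)$ the adjacency matrix and $D(G)$ the diagonal outdegree matrix, and $\phi_\alpha(G)=\det(xI-A_\alpha(G))$. An internal directed path of $G$ is a directed path of $G$ all of whose internal vertices have indegree $1$ and outdegree $1$ in $G$. -}

module Defs where

open import Level using (Level)
open import Data.Nat using (ℕ; zero; suc; _<_)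
import Data.Nat as ℕ
open import Data.Fin using (Fin; zero; suc; toℕ; inject₁; punchIn; splitAt; _≟_)
open import Data.Bool using (Bool; true; false; _∨_; if_then_else_)
open import Data.Sum using (_⊎_; inj₁; inj₂)
open import Data.Maybe using (Maybe; just; nothing)
open import Data.Product using (Σ; ∃; _×_; _,_)
open import Relation.Nullary.Decidable using (⌊_⌋)
open import Relation.Binary.PropositionalEquality using (_≡_)
open import Function.Definitions using (Injective)
open import Algebra.Bundles using (CommutativeRing)

-- A digraph on the vertex set Fin n, given by its arc relation
-- (at most one arc from i to j, so no multiple arcs).
record Digraph (n : ℕ) : Set where
  field
    arc : Fin n → Fin n → Bool
open Digraph public

Loopless : ∀ {n} → Digraph n → Set
Loopless {n} G = ∀ (i : Fin n) → arc G i i ≡ false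

count : ∀ {n} → (Fin n → Bool) → ℕ
count {zero} f = 0
count {suc n} f = (if f zero then 1 else 0) ℕ.+ count (λ j → f (suc j))

outdeg : ∀ {n} → Digraph n → Fin n → ℕ
outdeg G i = count (λ j → arc G i j)

indeg : ∀ {n} → Digraph n → Fin n → ℕ
indeg G i = count (λ j → arc G j i)

record InternalPath {n : ℕ} (G : Digraph n) : Set where
  field
    len      : ℕ
    vtx      : Fin (suc len) → Fin n
    distinct : Injective _≡_ _≡_ vtx
    arcs     : ∀ (i : Fin len) → arc G (vtx (inject₁ i)) (vtx (suc i)) ≡ true
    internalDeg : ∀ (i : Fin (suc len)) → 0 < toℕ i → toℕ i < len →
                  (indeg G (vtx i) ≡ 1) × (outdeg G (vtx i) ≡ 1)
open InternalPath public

IsInternalVertexOf : ∀ {n} {G : Digraph n} → InternalPath G → Fin n → Set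
IsInternalVertexOf P u =
  ∃ λ (i : Fin (suc (len P))) → (0 < toℕ i) × (toℕ i < len P) × (vtx P i ≡ u)

-- Vertex set Fin (n ℕ.+ m): the first n vertices are
-- those of G (u playing the role of the identified vertex), the last m are
-- the vertices of H other than w (H-vertex punchIn w j ↦ n + j).
module _ {n m : ℕ} (G : Digraph n) (u : Fin n) (H : Digraph (suc m)) (w : Fin (suc m)) where
  private
    gPart : Fin (n ℕ.+ m) → Maybe (Fin n)
    gPart c with splitAt n c
    ... | inj₁ i = just i
    ... | inj₂ _ = nothing

    hPart : Fin (n ℕ.+ m) → Maybe (Fin (suc m))
    hPart c with splitAt n c
    ... | inj₁ i = if ⌊ i ≟ u ⌋ then just w else nothing
    ... | inj₂ j = just (punchIn w j)

    gArc : Maybe (Fin n) → Maybe (Fin n) → Bool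
    gArc (just i) (just j) = arc G i j
    gArc _ _ = false

    hArc : Maybe (Fin (suc m)) → Maybe (Fin (suc m)) → Bool
    hArc (just i) (just j) = arc H i j
    hArc _ _ = false

  coalesce : Digraph (n ℕ.+ m)
  coalesce = record { arc = λ a b → gArc (gPart a) (gPart b) ∨ hArc (hPart a) (hPart b) }

module _ {c ℓ : Level} (R : CommutativeRing c ℓ) where
  open CommutativeRing R using (Carrier; _+_; _*_; -_; _-_; 0#; 1#)

  fromℕ : ℕ → Carrier
  fromℕ zero = 0#
  fromℕ (suc k) = 1# + fromℕ k

  Matrix : ℕ → Set c
  Matrix k = Fin k → Fin k → Carrier

  sumFin : ∀ {k} → (Fin k → Carrier) → Carrier
  sumFin {zero} f = 0#
  sumFin {suc k} f = f zero + sumFin (λ j → f (suc j))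

  signPow : ℕ → Carrier
  signPow zero = 1#
  signPow (suc k) = - signPow k

  det : ∀ {k} → Matrix k → Carrier
  det {zero} M = 1#
  det {suc k} M =
    sumFin (λ j → signPow (toℕ j) * (M zero j * det (λ a b → M (suc a) (punchIn j b))))

  δ : ∀ {k} → Fin k → Fin k → Carrier → Carrier
  δ i j x = if ⌊ i ≟ j ⌋ then x else 0#

  Aα : ∀ {k} → Carrier → Digraph k → Matrix k
  Aα α G i j = δ i j (α * fromℕ (outdeg G i))
             + (1# - α) * (if arc G i j then 1# else 0#)

  charPoly : ∀ {k} → Carrier → Digraph k → Carrier → Carrier
  charPoly α G x = det (λ i j → δ i j x - Aα α G i j)

module Submission where

-- Order the vertices of G u:w H as those of G followed by those of H − w. The matrix
-- xI − A_α(G u:w H) then carries xI − A_α(G) as its top-left block, except that the entry at u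
-- drops by α d⁺_H(w), and its off-diagonal blocks vanish outside row u and column u. For such
-- a matrix a Laplace-type expansion gives
--   φ_α(G u:w H) = (φ_α(G) − α d⁺_H(w) μ(u)) · μ_H(w) + μ(u) · χ,
-- with μ(u) the principal minor of xI − A_α(G) at u and μ_H(w), χ depending on H and w only.
-- Along an internal path, consecutive internal vertices u → v satisfy μ(u) = μ(v): column v of
-- the minor at u and row u of the minor at v each have a single nonzero entry x − α, and both
-- expansions leave the principal minor at {u, v}.

open import Defs hiding (Matrix; sumFin; signPow; det; δ)
open import Level using (Level)
open import Algebra.Bundles using (CommutativeRing)
import Algebra.Properties.CommutativeSemigroup as CommutativeSemigroupProperties
import Algebra.Properties.Ring as RingProperties
import Algebra.Solver.CommutativeMonoid as CommutativeMonoidSolver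
open import Data.Bool using (Bool; true; false; if_then_else_)
open import Data.Bool.Properties using (∨-identityʳ)
open import Data.Empty using (⊥-elim)
open import Data.Fin as Fin using (Fin; zero; suc; toℕ; punchIn; pinch; _↑ˡ_; _↑ʳ_; _≟_)
import Data.Fin.Properties as Fin
open import Data.Nat as ℕ using (ℕ; zero; suc)
import Data.Nat.Properties as ℕ
open import Data.Product using (_×_; _,_; proj₁; proj₂)
open import Function using (_∘_)
open import Function.Definitions using (Injective)
open import Relation.Nullary.Decidable using (⌊_⌋; yes; no)
open import Relation.Binary.PropositionalEquality as ≡
  using (_≡_; _≢_; refl; cong; cong₂; module ≡-Reasoning)
import Relation.Binary.Reasoning.Setoid as SetoidReasoning

private
  variable
    k k′ a b : ℕ

punchIn-pinch : ∀ (i : Fin (suc k)) (j : Fin k) → punchIn (punchIn i j) (pinch j i) ≡ i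
punchIn-pinch {suc k} zero    j       = refl
punchIn-pinch {suc k} (suc i) zero    = refl
punchIn-pinch {suc k} (suc i) (suc j) = cong suc (punchIn-pinch i j)

punchIn-punchIn-pinch : ∀ (i : Fin (suc (suc k))) (j : Fin (suc k)) (l : Fin k) →
                        punchIn (punchIn i j) (punchIn (pinch j i) l) ≡ punchIn i (punchIn j l)
punchIn-punchIn-pinch zero    j       l       = refl
punchIn-punchIn-pinch (suc i) zero    l       = refl
punchIn-punchIn-pinch {suc k} (suc i) (suc j) zero    = refl
punchIn-punchIn-pinch {suc k} (suc i) (suc j) (suc l) = cong suc (punchIn-punchIn-pinch i j l)

⌊≟⌋-injective : ∀ {a b} (f : Fin a → Fin b) → Injective _≡_ _≡_ f →
                ∀ i j → ⌊ f i ≟ f j ⌋ ≡ ⌊ i ≟ j ⌋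
⌊≟⌋-injective f f-inj i j with f i ≟ f j | i ≟ j
... | yes _      | yes _   = refl
... | no  _      | no  _   = refl
... | yes fi≡fj  | no  i≢j = ⊥-elim (i≢j (f-inj fi≡fj))
... | no  fi≢fj  | yes i≡j = ⊥-elim (fi≢fj (cong f i≡j))

indicator : Bool → ℕ
indicator b = if b then 1 else 0

count-cong : {f g : Fin k → Bool} → (∀ j → f j ≡ g j) → count f ≡ count g
count-cong {zero}  f≗g = refl
count-cong {suc k} f≗g = cong₂ ℕ._+_ (cong indicator (f≗g zero)) (count-cong (f≗g ∘ suc))

count-none : (f : Fin k → Bool) → (∀ j → f j ≡ false) → count f ≡ 0
count-none {zero}  f none = refl
count-none {suc k} f none rewrite none zero = count-none (f ∘ suc) (none ∘ suc)

count≡0⇒false : (f : Fin k → Bool) → count f ≡ 0 → ∀ j → f j ≡ false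
count≡0⇒false {suc k} f count≡0 j with f zero in f0
count≡0⇒false {suc k} f count≡0 zero    | false = f0
count≡0⇒false {suc k} f count≡0 (suc j) | false = count≡0⇒false (f ∘ suc) count≡0 j

count-punchIn : (f : Fin (suc k) → Bool) (i : Fin (suc k)) →
                count f ≡ indicator (f i) ℕ.+ count (f ∘ punchIn i)
count-punchIn f zero = refl
count-punchIn {suc k} f (suc i) = ≡.trans (cong (indicator (f zero) ℕ.+_) (count-punchIn (f ∘ suc) i))
  (CommutativeSemigroupProperties.x∙yz≈y∙xz ℕ.+-commutativeSemigroup
    (indicator (f zero)) (indicator (f (suc i))) (count (f ∘ suc ∘ punchIn i)))

count≡1⇒unique : (f : Fin (suc k) → Bool) (i : Fin (suc k)) → count f ≡ 1 → f i ≡ true →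
                 ∀ j → f (punchIn i j) ≡ false
count≡1⇒unique f i count≡1 fi≡true =
  count≡0⇒false (f ∘ punchIn i) (ℕ.suc-injective (≡.trans (≡.sym count-f) count≡1))
  where
  count-f : count f ≡ suc (count (f ∘ punchIn i))
  count-f = ≡.trans (count-punchIn f i) (cong (λ b → indicator b ℕ.+ count (f ∘ punchIn i)) fi≡true)

count-↑ : ∀ a b (f : Fin (a ℕ.+ b) → Bool) →
          count f ≡ count (f ∘ (_↑ˡ b)) ℕ.+ count (f ∘ (a ↑ʳ_))
count-↑ zero    b f = refl
count-↑ (suc a) b f = ≡.trans (cong (indicator (f zero) ℕ.+_) (count-↑ a b (f ∘ suc)))
                              (≡.sym (ℕ.+-assoc (indicator (f zero)) (count (f ∘ suc ∘ (_↑ˡ b))) _))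

punchIn-↑ˡ : ∀ b (j : Fin (suc a)) (i : Fin a) → punchIn (j ↑ˡ b) (i ↑ˡ b) ≡ punchIn j i ↑ˡ b
punchIn-↑ˡ b zero    i       = refl
punchIn-↑ˡ b (suc j) zero    = refl
punchIn-↑ˡ b (suc j) (suc i) = cong suc (punchIn-↑ˡ b j i)

punchIn-↑ʳ : ∀ b (j : Fin (suc a)) (h : Fin b) → punchIn (j ↑ˡ b) (a ↑ʳ h) ≡ suc a ↑ʳ h
punchIn-↑ʳ         b zero    h = refl
punchIn-↑ʳ {suc a} b (suc j) h = cong suc (punchIn-↑ʳ b j h)

⌊≟⌋-refl : (i : Fin k) → ⌊ i ≟ i ⌋ ≡ true
⌊≟⌋-refl i with i ≟ i
... | yes _   = refl
... | no  i≢i = ⊥-elim (i≢i refl)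

⌊≟⌋-≢ : {i j : Fin k} → i ≢ j → ⌊ i ≟ j ⌋ ≡ false
⌊≟⌋-≢ {i = i} {j} i≢j with i ≟ j
... | yes i≡j = ⊥-elim (i≢j i≡j)
... | no  _   = refl

swap01 : Fin (suc (suc k)) → Fin (suc (suc k))
swap01 zero          = suc zero
swap01 (suc zero)    = zero
swap01 (suc (suc i)) = suc (suc i)

swap01-↑ˡ : ∀ b (i : Fin (suc (suc a))) → swap01 (i ↑ˡ b) ≡ swap01 i ↑ˡ b
swap01-↑ˡ b zero          = refl
swap01-↑ˡ b (suc zero)    = refl
swap01-↑ˡ b (suc (suc i)) = refl

↑ˡ≢↑ʳ : ∀ (i : Fin a) (h : Fin b) → i ↑ˡ b ≢ a ↑ʳ h
↑ˡ≢↑ʳ zero    h ()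
↑ˡ≢↑ʳ (suc i) h eq = ↑ˡ≢↑ʳ i h (Fin.suc-injective eq)

module Coalescence {n m : ℕ} (G : Digraph (suc n)) (u : Fin (suc n))
                   (H : Digraph (suc m)) (w : Fin (suc m)) (H-loopless : Loopless H) where

  C : Digraph (suc n ℕ.+ m)
  C = coalesce G u H w

  arc-G-G : ∀ i j → arc C (i ↑ˡ m) (j ↑ˡ m) ≡ arc G i j
  arc-G-G i j rewrite Fin.splitAt-↑ˡ (suc n) i m | Fin.splitAt-↑ˡ (suc n) j m with i ≟ u | j ≟ u
  ... | yes _ | yes _ rewrite H-loopless w = ∨-identityʳ _
  ... | yes _ | no  _ = ∨-identityʳ _
  ... | no  _ | yes _ = ∨-identityʳ _
  ... | no  _ | no  _ = ∨-identityʳ _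

  arc-u-H : ∀ h → arc C (u ↑ˡ m) (suc n ↑ʳ h) ≡ arc H w (punchIn w h)
  arc-u-H h rewrite Fin.splitAt-↑ˡ (suc n) u m | Fin.splitAt-↑ʳ (suc n) m h | ⌊≟⌋-refl u = refl

  arc-G-H : ∀ i h → i ≢ u → arc C (i ↑ˡ m) (suc n ↑ʳ h) ≡ false
  arc-G-H i h i≢u rewrite Fin.splitAt-↑ˡ (suc n) i m | Fin.splitAt-↑ʳ (suc n) m h | ⌊≟⌋-≢ i≢u = refl

  arc-H-u : ∀ h → arc C (suc n ↑ʳ h) (u ↑ˡ m) ≡ arc H (punchIn w h) w
  arc-H-u h rewrite Fin.splitAt-↑ˡ (suc n) u m | Fin.splitAt-↑ʳ (suc n) m h | ⌊≟⌋-refl u = refl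

  arc-H-G : ∀ h j → j ≢ u → arc C (suc n ↑ʳ h) (j ↑ˡ m) ≡ false
  arc-H-G h j j≢u rewrite Fin.splitAt-↑ˡ (suc n) j m | Fin.splitAt-↑ʳ (suc n) m h | ⌊≟⌋-≢ j≢u = refl

  arc-H-H : ∀ h h′ → arc C (suc n ↑ʳ h) (suc n ↑ʳ h′) ≡ arc H (punchIn w h) (punchIn w h′)
  arc-H-H h h′ rewrite Fin.splitAt-↑ʳ (suc n) m h | Fin.splitAt-↑ʳ (suc n) m h′ = refl

  outdeg-↑ˡ : ∀ i → outdeg C (i ↑ˡ m) ≡ outdeg G i ℕ.+ count (λ h → arc C (i ↑ˡ m) (suc n ↑ʳ h))
  outdeg-↑ˡ i = ≡.trans (count-↑ (suc n) m (arc C (i ↑ˡ m)))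
                        (cong (ℕ._+ count (λ h → arc C (i ↑ˡ m) (suc n ↑ʳ h))) (count-cong (arc-G-G i)))

  outdeg-G : ∀ i → i ≢ u → outdeg C (i ↑ˡ m) ≡ outdeg G i
  outdeg-G i i≢u = ≡.trans (outdeg-↑ˡ i)
    (≡.trans (cong (outdeg G i ℕ.+_) (count-none _ λ h → arc-G-H i h i≢u)) (ℕ.+-identityʳ _))

  outdeg-u : outdeg C (u ↑ˡ m) ≡ outdeg G u ℕ.+ outdeg H w
  outdeg-u = ≡.trans (outdeg-↑ˡ u) (cong (outdeg G u ℕ.+_) (≡.trans (count-cong arc-u-H) (≡.sym outdeg-w)))
    where
    outdeg-w : outdeg H w ≡ count (arc H w ∘ punchIn w)
    outdeg-w = ≡.trans (count-punchIn (arc H w) w)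
                       (cong (λ b → indicator b ℕ.+ count (arc H w ∘ punchIn w)) (H-loopless w))

  outdeg-H : ∀ h → outdeg C (suc n ↑ʳ h) ≡ outdeg H (punchIn w h)
  outdeg-H h = begin
    outdeg C (suc n ↑ʳ h)
      ≡⟨ count-↑ (suc n) m (arc C (suc n ↑ʳ h)) ⟩
    count (λ j → arc C (suc n ↑ʳ h) (j ↑ˡ m)) ℕ.+ count (λ h′ → arc C (suc n ↑ʳ h) (suc n ↑ʳ h′))
      ≡⟨ cong₂ ℕ._+_ (count-punchIn (λ j → arc C (suc n ↑ʳ h) (j ↑ˡ m)) u) (count-cong (arc-H-H h)) ⟩
    (indicator (arc C (suc n ↑ʳ h) (u ↑ˡ m)) ℕ.+ count (λ l → arc C (suc n ↑ʳ h) (punchIn u l ↑ˡ m)))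
      ℕ.+ toH
      ≡⟨ cong (ℕ._+ toH) (cong₂ ℕ._+_ (cong indicator (arc-H-u h))
                                     (count-none _ λ l → arc-H-G h (punchIn u l) (Fin.punchInᵢ≢i u l))) ⟩
    (indicator (arc H (punchIn w h) w) ℕ.+ 0) ℕ.+ toH
      ≡⟨ cong (ℕ._+ toH) (ℕ.+-identityʳ _) ⟩
    indicator (arc H (punchIn w h) w) ℕ.+ toH
      ≡⟨ count-punchIn (arc H (punchIn w h)) w ⟨
    outdeg H (punchIn w h) ∎
    where
    open ≡-Reasoning
    toH = count (arc H (punchIn w h) ∘ punchIn w)

module Determinant {c ℓ} (R : CommutativeRing c ℓ) where
  open CommutativeRing R hiding (zero; refl)
  open RingProperties ring using (-‿distribˡ-*; -‿distribʳ-*; -‿involutive; -‿+-comm; -0#≈0#)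
  open CommutativeSemigroupProperties +-commutativeSemigroup using (interchange; x∙yz≈y∙xz)
  open SetoidReasoning setoid

  Matrix : ℕ → Set c
  Matrix = Defs.Matrix R

  sumFin : (Fin k → Carrier) → Carrier
  sumFin = Defs.sumFin R

  signPow : ℕ → Carrier
  signPow = Defs.signPow R

  det : Matrix k → Carrier
  det = Defs.det R

  δ : Fin k → Fin k → Carrier → Carrier
  δ = Defs.δ R

  δ-diagonal : (i : Fin k) (z : Carrier) → δ i i z ≡ z
  δ-diagonal i z with i ≟ i
  ... | yes _   = refl
  ... | no  i≢i = ⊥-elim (i≢i refl)

  δ-offDiagonal : (i j : Fin k) (z : Carrier) → i ≢ j → δ i j z ≡ 0#
  δ-offDiagonal i j z i≢j with i ≟ j
  ... | yes i≡j = ⊥-elim (i≢j i≡j)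
  ... | no  _   = refl

  -x*-y≈x*y : ∀ x y → - x * - y ≈ x * y
  -x*-y≈x*y x y = begin
    - x * - y     ≈⟨ -‿distribˡ-* x (- y) ⟨
    - (x * - y)   ≈⟨ -‿cong (-‿distribʳ-* x y) ⟨
    - - (x * y)   ≈⟨ -‿involutive (x * y) ⟩
    x * y         ∎

  *-zeroˡ-term : ∀ a {b} d → b ≈ 0# → a * (b * d) ≈ 0#
  *-zeroˡ-term a d b≈0 = trans (*-congˡ (trans (*-congʳ b≈0) (zeroˡ d))) (zeroʳ a)

  *-zeroʳ-term : ∀ a b {d} → d ≈ 0# → a * (b * d) ≈ 0#
  *-zeroʳ-term a b d≈0 = trans (*-congˡ (trans (*-congˡ d≈0) (zeroʳ b))) (zeroʳ a)

  sumFin-cong : {f g : Fin k → Carrier} → (∀ j → f j ≈ g j) → sumFin f ≈ sumFin g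
  sumFin-cong {zero}  f≈g = reflexive refl
  sumFin-cong {suc k} f≈g = +-cong (f≈g zero) (sumFin-cong (f≈g ∘ suc))

  sumFin-+ : (f g : Fin k → Carrier) → sumFin (λ j → f j + g j) ≈ sumFin f + sumFin g
  sumFin-+ {zero}  f g = sym (+-identityʳ 0#)
  sumFin-+ {suc k} f g = trans (+-congˡ (sumFin-+ (f ∘ suc) (g ∘ suc)))
                               (interchange (f zero) (g zero) (sumFin (f ∘ suc)) (sumFin (g ∘ suc)))

  sumFin-*ˡ : (a : Carrier) (f : Fin k → Carrier) → sumFin (λ j → a * f j) ≈ a * sumFin f
  sumFin-*ˡ {zero}  a f = sym (zeroʳ a)
  sumFin-*ˡ {suc k} a f = trans (+-congˡ (sumFin-*ˡ a (f ∘ suc))) (sym (distribˡ a _ _))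

  sumFin-*ʳ : (a : Carrier) (f : Fin k → Carrier) → sumFin (λ j → f j * a) ≈ sumFin f * a
  sumFin-*ʳ a f = trans (sumFin-cong (λ j → *-comm (f j) a)) (trans (sumFin-*ˡ a f) (*-comm a _))

  sumFin-neg : (f : Fin k → Carrier) → sumFin (λ j → - f j) ≈ - sumFin f
  sumFin-neg {zero}  f = sym -0#≈0#
  sumFin-neg {suc k} f = trans (+-congˡ (sumFin-neg (f ∘ suc))) (-‿+-comm (f zero) _)

  sumFin-zero : (f : Fin k → Carrier) → (∀ j → f j ≈ 0#) → sumFin f ≈ 0#
  sumFin-zero {zero}  f f≈0 = reflexive refl
  sumFin-zero {suc k} f f≈0 =
    trans (+-cong (f≈0 zero) (sumFin-zero (f ∘ suc) (f≈0 ∘ suc))) (+-identityʳ 0#)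

  sumFin-punchIn : (f : Fin (suc k) → Carrier) (i : Fin (suc k)) →
                   sumFin f ≈ f i + sumFin (f ∘ punchIn i)
  sumFin-punchIn f zero = reflexive refl
  sumFin-punchIn {suc k} f (suc i) = trans (+-congˡ (sumFin-punchIn (f ∘ suc) i))
                                           (x∙yz≈y∙xz (f zero) (f (suc i)) _)

  sumFin-↑ : ∀ a b (f : Fin (a ℕ.+ b) → Carrier) →
             sumFin f ≈ sumFin (f ∘ (_↑ˡ b)) + sumFin (f ∘ (a ↑ʳ_))
  sumFin-↑ zero    b f = sym (+-identityˡ _)
  sumFin-↑ (suc a) b f = trans (+-congˡ (sumFin-↑ a b (f ∘ suc))) (sym (+-assoc _ _ _))

  signPow-+ : ∀ a b → signPow (a ℕ.+ b) ≈ signPow a * signPow b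
  signPow-+ zero    b = sym (*-identityˡ _)
  signPow-+ (suc a) b = trans (-‿cong (signPow-+ a b)) (-‿distribˡ-* _ _)

  signPow-double : ∀ a → signPow (a ℕ.+ a) ≈ 1#
  signPow-double a = trans (signPow-+ a a) (square a)
    where
    square : ∀ a → signPow a * signPow a ≈ 1#
    square zero    = *-identityˡ 1#
    square (suc a) = trans (-x*-y≈x*y _ _) (square a)

  signPow-punchIn-pinch : ∀ (i : Fin (suc k)) (j : Fin k) →
    signPow (toℕ (punchIn i j)) * signPow (toℕ (pinch j i)) ≈ - (signPow (toℕ i) * signPow (toℕ j))
  signPow-punchIn-pinch {suc k} zero    j    = trans (*-identityʳ _) (-‿cong (sym (*-identityˡ _)))
  signPow-punchIn-pinch {suc k} (suc i) zero = trans (*-identityˡ _)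
                                        (sym (trans (-‿cong (*-identityʳ _)) (-‿involutive _)))
  signPow-punchIn-pinch {suc k} (suc i) (suc j) =
    trans (-x*-y≈x*y _ _) (trans (signPow-punchIn-pinch i j) (-‿cong (sym (-x*-y≈x*y _ _))))

  minor : Matrix (suc k) → Fin (suc k) → Fin (suc k) → Matrix k
  minor M i j r s = M (punchIn i r) (punchIn j s)

  laplaceTerm : Matrix (suc k) → Fin (suc k) → Carrier
  laplaceTerm M j = signPow (toℕ j) * (M zero j * det (minor M zero j))

  det-cong : {M N : Matrix k} → (∀ i j → M i j ≈ N i j) → det M ≈ det N
  det-cong {zero}  M≈N = reflexive refl
  det-cong {suc k} M≈N = sumFin-cong λ j →
    *-congˡ {signPow (toℕ j)} (*-cong (M≈N zero j) (det-cong (λ r s → M≈N (suc r) (punchIn j s))))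

  det-cong-≡ : {M N : Matrix k} → (∀ i j → M i j ≡ N i j) → det M ≈ det N
  det-cong-≡ M≡N = det-cong (λ i j → reflexive (M≡N i j))

  det-zeroRow : (M : Matrix k) (i : Fin k) → (∀ j → M i j ≈ 0#) → det M ≈ 0#
  det-zeroRow M zero    row≈0 = sumFin-zero (laplaceTerm M) λ j →
    *-zeroˡ-term (signPow (toℕ j)) (det (minor M zero j)) (row≈0 j)
  det-zeroRow M (suc i) row≈0 = sumFin-zero (laplaceTerm M) λ j →
    *-zeroʳ-term (signPow (toℕ j)) (M zero j) (det-zeroRow (minor M zero j) i (row≈0 ∘ punchIn j))

  det-zeroColumn : (M : Matrix k) (j : Fin k) → (∀ i → M i j ≈ 0#) → det M ≈ 0#
  det-zeroColumn {suc k} M j col≈0 = begin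
    det M
      ≈⟨ sumFin-punchIn (laplaceTerm M) j ⟩
    laplaceTerm M j + sumFin (laplaceTerm M ∘ punchIn j)
      ≈⟨ +-cong (*-zeroˡ-term _ _ (col≈0 zero)) (sumFin-zero (laplaceTerm M ∘ punchIn j) otherTerm≈0) ⟩
    0# + 0#
      ≈⟨ +-identityʳ 0# ⟩
    0# ∎
    where
    otherTerm≈0 : ∀ l → laplaceTerm M (punchIn j l) ≈ 0#
    otherTerm≈0 l = *-zeroʳ-term (signPow (toℕ (punchIn j l))) (M zero (punchIn j l))
      (det-zeroColumn (minor M zero (punchIn j l)) (pinch l j) λ i →
        trans (reflexive (cong (M (suc i)) (punchIn-pinch j l))) (col≈0 (suc i)))

  -- Reassembles an expansion along row 0 whose minors were expanded at column pinch l j.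
  sumFin-pinch : ∀ (i : ℕ) (j : Fin (suc k)) (X : Carrier) (m D : Fin k → Carrier) →
    sumFin (λ l → signPow (toℕ (punchIn j l)) * (m l * (signPow (i ℕ.+ toℕ (pinch l j)) * (X * D l))))
      ≈ signPow (suc i ℕ.+ toℕ j) * (X * sumFin (λ l → signPow (toℕ l) * (m l * D l)))
  sumFin-pinch {k} i j X m D = begin
    sumFin (λ l → signPow (toℕ (punchIn j l)) * (m l * (signPow (i ℕ.+ toℕ (pinch l j)) * (X * D l))))
      ≈⟨ sumFin-cong term ⟩
    sumFin (λ l → signPow (suc i ℕ.+ toℕ j) * (X * (signPow (toℕ l) * (m l * D l))))
      ≈⟨ sumFin-*ˡ {k} _ _ ⟩
    signPow (suc i ℕ.+ toℕ j) * sumFin (λ l → X * (signPow (toℕ l) * (m l * D l)))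
      ≈⟨ *-congˡ (sumFin-*ˡ {k} X _) ⟩
    signPow (suc i ℕ.+ toℕ j) * (X * sumFin (λ l → signPow (toℕ l) * (m l * D l))) ∎
    where
    open CommutativeMonoidSolver *-commutativeMonoid using (solve; _⊕_; _⊜_)
    term : ∀ l → signPow (toℕ (punchIn j l)) * (m l * (signPow (i ℕ.+ toℕ (pinch l j)) * (X * D l)))
               ≈ signPow (suc i ℕ.+ toℕ j) * (X * (signPow (toℕ l) * (m l * D l)))
    term l = begin
      sp * (m l * (signPow (i ℕ.+ toℕ (pinch l j)) * (X * D l)))
        ≈⟨ *-congˡ (*-congˡ (*-congʳ (signPow-+ i (toℕ (pinch l j))))) ⟩
      sp * (m l * ((si * sq) * (X * D l)))
        ≈⟨ solve 6 (λ a b c d e f → (a ⊕ (b ⊕ ((c ⊕ d) ⊕ (e ⊕ f))))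
                                  ⊜ ((a ⊕ d) ⊕ (c ⊕ (e ⊕ (b ⊕ f)))))
                   (reflexive refl) sp (m l) si sq X (D l) ⟩
      (sp * sq) * (si * (X * (m l * D l)))
        ≈⟨ *-congʳ (signPow-punchIn-pinch j l) ⟩
      - (sj * sl) * (si * (X * (m l * D l)))
        ≈⟨ -‿distribˡ-* _ _ ⟨
      - ((sj * sl) * (si * (X * (m l * D l))))
        ≈⟨ -‿cong (solve 6 (λ a b c d e f → ((a ⊕ b) ⊕ (c ⊕ (d ⊕ (e ⊕ f))))
                                          ⊜ ((c ⊕ a) ⊕ (d ⊕ (b ⊕ (e ⊕ f)))))
                           (reflexive refl) sj sl si X (m l) (D l)) ⟩
      - ((si * sj) * (X * (sl * (m l * D l))))
        ≈⟨ -‿distribˡ-* _ _ ⟩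
      - (si * sj) * (X * (sl * (m l * D l)))
        ≈⟨ *-congʳ (-‿cong (signPow-+ i (toℕ j))) ⟨
      signPow (suc i ℕ.+ toℕ j) * (X * (sl * (m l * D l))) ∎
      where
      sp = signPow (toℕ (punchIn j l))
      sq = signPow (toℕ (pinch l j))
      si = signPow i
      sj = signPow (toℕ j)
      sl = signPow (toℕ l)

  det-expandFirstRow : (M : Matrix (suc (suc k))) (i : Fin (suc k)) (j : Fin (suc (suc k))) →
    laplaceTerm M j ≈ 0# →
    (∀ l → let N = minor M zero (punchIn j l) in
           det N ≈ signPow (toℕ i ℕ.+ toℕ (pinch l j)) * (N i (pinch l j) * det (minor N i (pinch l j)))) →
    det M ≈ signPow (toℕ (suc i) ℕ.+ toℕ j) * (M (suc i) j * det (minor M (suc i) j))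
  det-expandFirstRow {k} M i j term≈0 minor≈ = begin
    det M
      ≈⟨ sumFin-punchIn (laplaceTerm M) j ⟩
    laplaceTerm M j + sumFin (laplaceTerm M ∘ punchIn j)
      ≈⟨ +-cong term≈0 (sumFin-cong λ l →
           *-congˡ {signPow (toℕ (punchIn j l))} (*-congˡ {M zero (punchIn j l)} (minor≈′ l))) ⟩
    0# + sumFin (λ l → signPow (toℕ (punchIn j l)) * (M zero (punchIn j l)
                         * (signPow (toℕ i ℕ.+ toℕ (pinch l j)) * (M (suc i) j * D l))))
      ≈⟨ +-identityˡ _ ⟩
    _ ≈⟨ sumFin-pinch (toℕ i) j (M (suc i) j) (λ l → M zero (punchIn j l)) D ⟩
    signPow (toℕ (suc i) ℕ.+ toℕ j) * (M (suc i) j * det (minor M (suc i) j)) ∎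
    where
    D : Fin (suc k) → Carrier
    D l = det (minor (minor M (suc i) j) zero l)
    minor≈′ : ∀ l → det (minor M zero (punchIn j l))
                      ≈ signPow (toℕ i ℕ.+ toℕ (pinch l j)) * (M (suc i) j * D l)
    minor≈′ l = trans (minor≈ l) (*-congˡ (*-cong
      (reflexive (cong (M (suc i)) (punchIn-pinch j l)))
      (det-cong-≡ λ r s → cong (M (suc (punchIn i r))) (punchIn-punchIn-pinch j l s))))

  det-singleRow : (M : Matrix (suc k)) (i j : Fin (suc k)) → (∀ l → M i (punchIn j l) ≈ 0#) →
                  det M ≈ signPow (toℕ i ℕ.+ toℕ j) * (M i j * det (minor M i j))
  det-singleRow M zero j row≈0 = begin
    det M                                                ≈⟨ sumFin-punchIn (laplaceTerm M) j ⟩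
    laplaceTerm M j + sumFin (laplaceTerm M ∘ punchIn j) ≈⟨ +-congˡ (sumFin-zero _ otherTerm≈0) ⟩
    laplaceTerm M j + 0#                                 ≈⟨ +-identityʳ _ ⟩
    laplaceTerm M j                                      ∎
    where
    otherTerm≈0 : ∀ l → laplaceTerm M (punchIn j l) ≈ 0#
    otherTerm≈0 l = *-zeroˡ-term _ (det (minor M zero (punchIn j l))) (row≈0 l)
  det-singleRow {suc k} M (suc i) j row≈0 = det-expandFirstRow M i j
    (*-zeroʳ-term _ _ (det-zeroRow (minor M zero j) i row≈0))
    (λ l → det-singleRow (minor M zero (punchIn j l)) i (pinch l j) λ s →
             trans (reflexive (cong (M (suc i)) (punchIn-punchIn-pinch j l s))) (row≈0 (punchIn l s)))

  det-singleColumn : (M : Matrix (suc k)) (i j : Fin (suc k)) → (∀ l → M (punchIn i l) j ≈ 0#) →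
                     det M ≈ signPow (toℕ i ℕ.+ toℕ j) * (M i j * det (minor M i j))
  det-singleColumn M zero j column≈0 = begin
    det M                                                ≈⟨ sumFin-punchIn (laplaceTerm M) j ⟩
    laplaceTerm M j + sumFin (laplaceTerm M ∘ punchIn j) ≈⟨ +-congˡ (sumFin-zero _ otherTerm≈0) ⟩
    laplaceTerm M j + 0#                                 ≈⟨ +-identityʳ _ ⟩
    laplaceTerm M j                                      ∎
    where
    otherTerm≈0 : ∀ l → laplaceTerm M (punchIn j l) ≈ 0#
    otherTerm≈0 l = *-zeroʳ-term _ _ (det-zeroColumn (minor M zero (punchIn j l)) (pinch l j) λ r →
      trans (reflexive (cong (M (suc r)) (punchIn-pinch j l))) (column≈0 r))
  det-singleColumn {suc k} M (suc i) j column≈0 = det-expandFirstRow M i j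
    (*-zeroˡ-term _ _ (column≈0 zero))
    (λ l → det-singleColumn (minor M zero (punchIn j l)) i (pinch l j) λ r →
             trans (reflexive (cong (M (suc (punchIn i r))) (punchIn-pinch j l))) (column≈0 (suc r)))

  det-rowAdditive : (A B C : Matrix (suc k)) (i : Fin (suc k)) →
    (∀ r s → A (punchIn i r) s ≈ B (punchIn i r) s) → (∀ r s → A (punchIn i r) s ≈ C (punchIn i r) s) →
    (∀ s → A i s ≈ B i s + C i s) → det A ≈ det B + det C
  det-rowAdditive A B C zero A≈B A≈C A≈B+C =
    trans (sumFin-cong term) (sumFin-+ (laplaceTerm B) (laplaceTerm C))
    where
    term : ∀ j → laplaceTerm A j ≈ laplaceTerm B j + laplaceTerm C j
    term j = begin
      σ * (A zero j * det (minor A zero j))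
        ≈⟨ *-congˡ (*-cong (A≈B+C j) (det-cong λ r s → A≈B r (punchIn j s))) ⟩
      σ * ((B zero j + C zero j) * det (minor B zero j))
        ≈⟨ trans (*-congˡ (distribʳ _ _ _)) (distribˡ _ _ _) ⟩
      σ * (B zero j * det (minor B zero j)) + σ * (C zero j * det (minor B zero j))
        ≈⟨ +-congˡ (*-congˡ (*-congˡ (det-cong λ r s →
             trans (sym (A≈B r (punchIn j s))) (A≈C r (punchIn j s))))) ⟩
      σ * (B zero j * det (minor B zero j)) + σ * (C zero j * det (minor C zero j)) ∎
      where σ = signPow (toℕ j)
  det-rowAdditive {suc k} A B C (suc i) A≈B A≈C A≈B+C =
    trans (sumFin-cong term) (sumFin-+ (laplaceTerm B) (laplaceTerm C))
    where
    term : ∀ j → laplaceTerm A j ≈ laplaceTerm B j + laplaceTerm C j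
    term j = begin
      σ * (A zero j * det (minor A zero j))
        ≈⟨ *-congˡ (*-congˡ (det-rowAdditive (minor A zero j) (minor B zero j) (minor C zero j) i
                              (λ r s → A≈B (suc r) (punchIn j s)) (λ r s → A≈C (suc r) (punchIn j s))
                              (A≈B+C ∘ punchIn j))) ⟩
      σ * (A zero j * (det (minor B zero j) + det (minor C zero j)))
        ≈⟨ trans (*-congˡ (distribˡ _ _ _)) (distribˡ _ _ _) ⟩
      σ * (A zero j * det (minor B zero j)) + σ * (A zero j * det (minor C zero j))
        ≈⟨ +-cong (*-congˡ (*-congʳ (A≈B zero j))) (*-congˡ (*-congʳ (A≈C zero j))) ⟩
      σ * (B zero j * det (minor B zero j)) + σ * (C zero j * det (minor C zero j)) ∎
      where σ = signPow (toℕ j)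

  updateRow : Matrix k → Fin k → (Fin k → Carrier) → Matrix k
  updateRow A i v r s = if ⌊ r ≟ i ⌋ then v s else A r s

  updateRow-updated : (A : Matrix k) (i : Fin k) (v : Fin k → Carrier) (s : Fin k) →
                      updateRow A i v i s ≡ v s
  updateRow-updated A i v s with i ≟ i
  ... | yes _   = refl
  ... | no  i≢i = ⊥-elim (i≢i refl)

  updateRow-other : (A : Matrix (suc k)) (i : Fin (suc k)) (v : Fin (suc k) → Carrier) →
                    ∀ r s → updateRow A i v (punchIn i r) s ≡ A (punchIn i r) s
  updateRow-other A i v r s with punchIn i r ≟ i
  ... | yes eq = ⊥-elim (Fin.punchInᵢ≢i i r eq)
  ... | no  _  = refl

  updateRow-twice : (A : Matrix k) (i : Fin k) (v v′ : Fin k → Carrier) (r s : Fin k) →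
                    updateRow (updateRow A i v) i v′ r s ≡ updateRow A i v′ r s
  updateRow-twice A i v v′ r s with r ≟ i
  ... | yes _ = refl
  ... | no  _ = refl

  det-rowSum : ∀ L (A : Matrix (suc k)) (i : Fin (suc k)) (v : Fin L → Fin (suc k) → Carrier) →
               (∀ s → A i s ≈ sumFin (λ l → v l s)) → det A ≈ sumFin (λ l → det (updateRow A i (v l)))
  det-rowSum zero    A i v row≈0 = det-zeroRow A i row≈0
  det-rowSum (suc L) A i v row≈sum = begin
    det A
      ≈⟨ det-rowAdditive A (updateRow A i (v zero)) (updateRow A i rest) i
           (λ r s → reflexive (≡.sym (updateRow-other A i (v zero) r s)))
           (λ r s → reflexive (≡.sym (updateRow-other A i rest r s)))
           (λ s → trans (row≈sum s) (reflexive (≡.sym (cong₂ _+_ (updateRow-updated A i (v zero) s)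
                                                                  (updateRow-updated A i rest s))))) ⟩
    det (updateRow A i (v zero)) + det (updateRow A i rest)
      ≈⟨ +-congˡ (det-rowSum L (updateRow A i rest) i (v ∘ suc) (reflexive ∘ updateRow-updated A i rest)) ⟩
    det (updateRow A i (v zero)) + sumFin (λ l → det (updateRow (updateRow A i rest) i (v (suc l))))
      ≈⟨ +-congˡ (sumFin-cong λ l → det-cong-≡ (updateRow-twice A i rest (v (suc l)))) ⟩
    sumFin (λ l → det (updateRow A i (v l))) ∎
    where
    rest : Fin (suc _) → Carrier
    rest s = sumFin (λ l → v (suc l) s)

  det-rowExpansion : (A : Matrix (suc k)) (i : Fin (suc k)) →
                     det A ≈ sumFin (λ j → signPow (toℕ i ℕ.+ toℕ j) * (A i j * det (minor A i j)))
  det-rowExpansion A i = trans (det-rowSum _ A i unit row≈sum) (sumFin-cong term)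
    where
    unit : Fin _ → Fin _ → Carrier
    unit j s = δ j s (A i j)
    row≈sum : ∀ s → A i s ≈ sumFin (λ l → unit l s)
    row≈sum s = sym (begin
      sumFin (λ l → unit l s)
        ≈⟨ sumFin-punchIn (λ l → unit l s) s ⟩
      unit s s + sumFin (λ l → unit (punchIn s l) s)
        ≈⟨ +-cong (reflexive (δ-diagonal s (A i s)))
                  (sumFin-zero _ λ l → reflexive (δ-offDiagonal (punchIn s l) s _ (Fin.punchInᵢ≢i s l))) ⟩
      A i s + 0#
        ≈⟨ +-identityʳ _ ⟩
      A i s ∎)
    term : ∀ j → det (updateRow A i (unit j)) ≈ signPow (toℕ i ℕ.+ toℕ j) * (A i j * det (minor A i j))
    term j = trans
      (det-singleRow (updateRow A i (unit j)) i j λ s →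
         reflexive (≡.trans (updateRow-updated A i (unit j) (punchIn j s))
                            (δ-offDiagonal j (punchIn j s) _ (Fin.punchInᵢ≢i j s ∘ ≡.sym))))
      (*-congˡ (*-cong (reflexive (≡.trans (updateRow-updated A i (unit j) j) (δ-diagonal j _)))
                       (det-cong-≡ λ r s → updateRow-other A i (unit j) r (punchIn j s))))

  det-swap01 : (M : Matrix (suc (suc k))) → det (M ∘ swap01) ≈ - det M
  det-swap01 M = begin
    det (M ∘ swap01)
      ≈⟨ sumFin-cong (λ j → *-congˡ {σ j} (*-congˡ {M (suc zero) j} (det-cong-≡ (minor-swap01 j)))) ⟩
    sumFin (λ j → σ j * X j)
      ≈⟨ -‿involutive _ ⟨
    - - sumFin (λ j → σ j * X j)
      ≈⟨ -‿cong (sumFin-neg (λ j → σ j * X j)) ⟨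
    - sumFin (λ j → - (σ j * X j))
      ≈⟨ -‿cong (sumFin-cong λ j → -‿distribˡ-* (σ j) (X j)) ⟩
    - sumFin (λ j → signPow (suc (toℕ j)) * X j)
      ≈⟨ -‿cong (det-rowExpansion M (suc zero)) ⟨
    - det M ∎
    where
    σ : Fin _ → Carrier
    σ j = signPow (toℕ j)
    X : Fin _ → Carrier
    X j = M (suc zero) j * det (minor M (suc zero) j)
    minor-swap01 : ∀ j r s → minor (M ∘ swap01) zero j r s ≡ minor M (suc zero) j r s
    minor-swap01 j zero    s = refl
    minor-swap01 j (suc r) s = refl

  det-addDiagonal : (A M : Matrix (suc k)) (i : Fin (suc k)) (z : Carrier) →
    (∀ r s → A (punchIn i r) s ≈ M (punchIn i r) s) → (∀ s → A i s ≈ M i s + δ i s z) →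
    det A ≈ det M + z * det (minor M i i)
  det-addDiagonal A M i z A≈M rowᵢ = trans
    (det-rowAdditive A M E i A≈M
      (λ r s → trans (A≈M r s) (reflexive (≡.sym (updateRow-other M i e r s))))
      (λ s → trans (rowᵢ s) (+-congˡ (reflexive (≡.sym (updateRow-updated M i e s))))))
    (+-congˡ det-E)
    where
    e : Fin _ → Carrier
    e s = δ i s z
    E : Matrix _
    E = updateRow M i e
    det-E : det E ≈ z * det (minor M i i)
    det-E = begin
      det E
        ≈⟨ det-singleRow E i i (λ s → reflexive (≡.trans (updateRow-updated M i e (punchIn i s))
                                          (δ-offDiagonal i (punchIn i s) z (Fin.punchInᵢ≢i i s ∘ ≡.sym)))) ⟩
      signPow (toℕ i ℕ.+ toℕ i) * (E i i * det (minor E i i))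
        ≈⟨ *-cong (signPow-double (toℕ i))
                  (*-cong (reflexive (≡.trans (updateRow-updated M i e i) (δ-diagonal i z)))
                          (det-cong-≡ λ r s → updateRow-other M i e r (punchIn i s))) ⟩
      1# * (z * det (minor M i i))
        ≈⟨ *-identityˡ _ ⟩
      z * det (minor M i i) ∎

  topLeft : ∀ a b → Matrix (a ℕ.+ b) → Matrix a
  topLeft a b M i j = M (i ↑ˡ b) (j ↑ˡ b)

  bottomRight : ∀ a b → Matrix (a ℕ.+ b) → Matrix b
  bottomRight a b M h h′ = M (a ↑ʳ h) (a ↑ʳ h′)

  det-blockLowerTriangular : ∀ a b (M : Matrix (a ℕ.+ b)) → (∀ i h → M (i ↑ˡ b) (a ↑ʳ h) ≈ 0#) →
                             det M ≈ det (topLeft a b M) * det (bottomRight a b M)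
  det-blockLowerTriangular zero    b M _          = sym (*-identityˡ _)
  det-blockLowerTriangular (suc a) b M topRight≈0 = begin
    det M
      ≈⟨ sumFin-↑ (suc a) b (laplaceTerm M) ⟩
    sumFin (laplaceTerm M ∘ (_↑ˡ b)) + sumFin (laplaceTerm M ∘ (suc a ↑ʳ_))
      ≈⟨ +-cong (sumFin-cong term) (sumFin-zero _ λ h → *-zeroˡ-term _ _ (topRight≈0 zero h)) ⟩
    sumFin (λ j → laplaceTerm A j * det D) + 0#
      ≈⟨ +-identityʳ _ ⟩
    sumFin (λ j → laplaceTerm A j * det D)
      ≈⟨ sumFin-*ʳ (det D) (laplaceTerm A) ⟩
    det A * det D ∎
    where
    A = topLeft (suc a) b M
    D = bottomRight (suc a) b M
    minor-det : ∀ j → det (minor M zero (j ↑ˡ b)) ≈ det (minor A zero j) * det D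
    minor-det j = trans
      (det-blockLowerTriangular a b (minor M zero (j ↑ˡ b)) λ i h →
         trans (reflexive (cong (M (suc (i ↑ˡ b))) (punchIn-↑ʳ b j h))) (topRight≈0 (suc i) h))
      (*-cong (det-cong-≡ λ i i′ → cong (M (suc (i ↑ˡ b))) (punchIn-↑ˡ b j i′))
              (det-cong-≡ λ h h′ → cong (M (suc (a ↑ʳ h))) (punchIn-↑ʳ b j h′)))
    term : ∀ j → laplaceTerm M (j ↑ˡ b) ≈ laplaceTerm A j * det D
    term j = begin
      signPow (toℕ (j ↑ˡ b)) * (M zero (j ↑ˡ b) * det (minor M zero (j ↑ˡ b)))
        ≈⟨ *-cong (reflexive (cong signPow (Fin.toℕ-↑ˡ j b))) (*-congˡ (minor-det j)) ⟩
      signPow (toℕ j) * (A zero j * (det (minor A zero j) * det D))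
        ≈⟨ *-congˡ (*-assoc _ _ _) ⟨
      signPow (toℕ j) * ((A zero j * det (minor A zero j)) * det D)
        ≈⟨ *-assoc _ _ _ ⟨
      laplaceTerm A j * det D ∎

  border : ∀ a b → Matrix (suc a ℕ.+ b) → Fin (suc a) → Fin (suc a) → Matrix (suc b)
  border a b M p q zero    zero     = 0#
  border a b M p q zero    (suc h)  = M (p ↑ˡ b) (suc a ↑ʳ h)
  border a b M p q (suc h) zero     = M (suc a ↑ʳ h) (q ↑ˡ b)
  border a b M p q (suc h) (suc h′) = M (suc a ↑ʳ h) (suc a ↑ʳ h′)

  TopRightOnlyInRow : ∀ a b → Matrix (suc a ℕ.+ b) → Fin (suc a) → Set ℓ
  TopRightOnlyInRow a b M p = ∀ r h → M (punchIn p r ↑ˡ b) (suc a ↑ʳ h) ≈ 0#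

  BottomLeftOnlyInColumn : ∀ a b → Matrix (suc a ℕ.+ b) → Fin (suc a) → Set ℓ
  BottomLeftOnlyInColumn a b M q = ∀ h r → M (suc a ↑ʳ h) (punchIn q r ↑ˡ b) ≈ 0#

  BorderExpansion : ∀ a b → Matrix (suc a ℕ.+ b) → Fin (suc a) → Fin (suc a) → Set ℓ
  BorderExpansion a b M p q =
    det M ≈ det (topLeft (suc a) b M) * det (bottomRight (suc a) b M)
          + signPow (toℕ p ℕ.+ toℕ q) * (det (minor (topLeft (suc a) b M) p q) * det (border a b M p q))

  x[y[zw]]≈[x[yz]]w : ∀ x y z w → x * (y * (z * w)) ≈ (x * (y * z)) * w
  x[y[zw]]≈[x[yz]]w x y z w = trans (*-congˡ (sym (*-assoc y z w))) (sym (*-assoc x (y * z) w))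

  -[-x*y]≈x*y : ∀ x y → - (- x * y) ≈ x * y
  -[-x*y]≈x*y x y = trans (-‿cong (sym (-‿distribˡ-* x y))) (-‿involutive (x * y))

  borderExpansion-base : ∀ b (M : Matrix (suc b)) → BorderExpansion zero b M zero zero
  borderExpansion-base b M = sym (+-cong diagonalTerm otherTerms)
    where
    D = bottomRight 1 b M
    W = border zero b M zero zero
    diagonalTerm : (1# * (M zero zero * 1#) + 0#) * det D ≈ laplaceTerm M zero
    diagonalTerm = begin
      (1# * (M zero zero * 1#) + 0#) * det D
        ≈⟨ *-congʳ (trans (+-identityʳ _) (trans (*-identityˡ _) (*-identityʳ _))) ⟩
      M zero zero * det D
        ≈⟨ *-identityˡ _ ⟨
      laplaceTerm M zero ∎
    minor-W : ∀ h r s → minor W zero (suc h) r s ≡ minor M zero (suc h) r s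
    minor-W h r zero    = refl
    minor-W h r (suc s) = refl
    otherTerms : 1# * (1# * (1# * (0# * det (minor W zero zero)) + sumFin (laplaceTerm W ∘ suc)))
                 ≈ sumFin (laplaceTerm M ∘ suc)
    otherTerms = begin
      1# * (1# * (1# * (0# * det (minor W zero zero)) + sumFin (laplaceTerm W ∘ suc)))
        ≈⟨ trans (*-identityˡ _) (*-identityˡ _) ⟩
      1# * (0# * det (minor W zero zero)) + sumFin (laplaceTerm W ∘ suc)
        ≈⟨ +-cong (*-zeroˡ-term _ _ (reflexive refl)) (sumFin-cong λ h →
             *-congˡ {signPow (toℕ (suc h))} (*-congˡ {M zero (suc h)} (det-cong-≡ (minor-W h)))) ⟩
      0# + sumFin (laplaceTerm M ∘ suc)
        ≈⟨ +-identityˡ _ ⟩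
      sumFin (laplaceTerm M ∘ suc) ∎

  -- Expanding along row 0 ≠ p: each minor again has the rank-one corner pattern, with the
  -- column q moved to pinch k q, so the induction hypothesis applies to it.
  borderExpansion-step : ∀ a b →
    (∀ M p q → TopRightOnlyInRow a b M p → BottomLeftOnlyInColumn a b M q → BorderExpansion a b M p q) →
    ∀ (M : Matrix (suc (suc a) ℕ.+ b)) p q →
    TopRightOnlyInRow (suc a) b M (suc p) → BottomLeftOnlyInColumn (suc a) b M q →
    BorderExpansion (suc a) b M (suc p) q
  borderExpansion-step a b expansion M p q topRight bottomLeft = begin
    det M
      ≈⟨ sumFin-↑ (suc (suc a)) b (laplaceTerm M) ⟩
    sumFin f + sumFin (laplaceTerm M ∘ (suc (suc a) ↑ʳ_))
      ≈⟨ +-cong (sumFin-punchIn f q) (sumFin-zero _ λ h → *-zeroˡ-term _ _ (topRight zero h)) ⟩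
    (f q + sumFin (f ∘ punchIn q)) + 0#
      ≈⟨ +-identityʳ _ ⟩
    f q + sumFin (f ∘ punchIn q)
      ≈⟨ +-cong term-q (sumFin-cong term-punchIn) ⟩
    laplaceTerm A q * det D + sumFin (λ k → laplaceTerm A (punchIn q k) * det D + Y k)
      ≈⟨ +-congˡ (sumFin-+ (λ k → laplaceTerm A (punchIn q k) * det D) Y) ⟩
    laplaceTerm A q * det D + (sumFin (λ k → laplaceTerm A (punchIn q k) * det D) + sumFin Y)
      ≈⟨ +-assoc _ _ _ ⟨
    (laplaceTerm A q * det D + sumFin (λ k → laplaceTerm A (punchIn q k) * det D)) + sumFin Y
      ≈⟨ +-cong (sym (sumFin-punchIn (λ j → laplaceTerm A j * det D) q))
                (sumFin-pinch (toℕ p) q (det W) (λ k → A zero (punchIn q k)) E) ⟩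
    sumFin (λ j → laplaceTerm A j * det D) + signPow (suc (toℕ p) ℕ.+ toℕ q) * (det W * det (minor A (suc p) q))
      ≈⟨ +-cong (sumFin-*ʳ (det D) (laplaceTerm A)) (*-congˡ (*-comm _ _)) ⟩
    det A * det D + signPow (suc (toℕ p) ℕ.+ toℕ q) * (det (minor A (suc p) q) * det W) ∎
    where
    A = topLeft (suc (suc a)) b M
    D = bottomRight (suc (suc a)) b M
    W = border (suc a) b M (suc p) q
    N : Fin (suc (suc a)) → Matrix (suc a ℕ.+ b)
    N j = minor M zero (j ↑ˡ b)
    f : Fin (suc (suc a)) → Carrier
    f j = laplaceTerm M (j ↑ˡ b)
    E : Fin (suc a) → Carrier
    E k = det (minor (minor A (suc p) q) zero k)
    Y : Fin (suc a) → Carrier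
    Y k = signPow (toℕ (punchIn q k))
          * (A zero (punchIn q k) * (signPow (toℕ p ℕ.+ toℕ (pinch k q)) * (det W * E k)))

    topRight-N : ∀ j → TopRightOnlyInRow a b (N j) p
    topRight-N j r h =
      trans (reflexive (cong (M (suc (punchIn p r ↑ˡ b))) (punchIn-↑ʳ b j h))) (topRight (suc r) h)
    topLeft-N : ∀ j i i′ → topLeft (suc a) b (N j) i i′ ≡ minor A zero j i i′
    topLeft-N j i i′ = cong (M (suc (i ↑ˡ b))) (punchIn-↑ˡ b j i′)
    bottomRight-N : ∀ j h h′ → bottomRight (suc a) b (N j) h h′ ≡ D h h′
    bottomRight-N j h h′ = cong (M (suc (suc a ↑ʳ h))) (punchIn-↑ʳ b j h′)

    det-N-q : det (N q) ≈ det (minor A zero q) * det D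
    det-N-q = begin
      det (N q)
        ≈⟨ expansion (N q) p p (topRight-N q) bottomLeft-N ⟩
      det (topLeft (suc a) b (N q)) * det (bottomRight (suc a) b (N q))
        + signPow (toℕ p ℕ.+ toℕ p) * (det (minor (topLeft (suc a) b (N q)) p p) * det (border a b (N q) p p))
        ≈⟨ +-cong (*-cong (det-cong-≡ (topLeft-N q)) (det-cong-≡ (bottomRight-N q)))
                  (*-zeroʳ-term _ _ (det-zeroColumn (border a b (N q) p p) zero firstColumn≈0)) ⟩
      det (minor A zero q) * det D + 0#
        ≈⟨ +-identityʳ _ ⟩
      det (minor A zero q) * det D ∎
      where
      bottomLeft-N : BottomLeftOnlyInColumn a b (N q) p
      bottomLeft-N h r = trans (reflexive (cong (M (suc (suc a ↑ʳ h))) (punchIn-↑ˡ b q (punchIn p r))))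
                               (bottomLeft h (punchIn p r))
      firstColumn≈0 : ∀ x → border a b (N q) p p x zero ≈ 0#
      firstColumn≈0 zero    = reflexive refl
      firstColumn≈0 (suc h) =
        trans (reflexive (cong (M (suc (suc a ↑ʳ h))) (punchIn-↑ˡ b q p))) (bottomLeft h p)

    det-N-punchIn : ∀ k → det (N (punchIn q k))
      ≈ det (minor A zero (punchIn q k)) * det D + signPow (toℕ p ℕ.+ toℕ (pinch k q)) * (det W * E k)
    det-N-punchIn k = begin
      det (N j)
        ≈⟨ expansion (N j) p (pinch k q) (topRight-N j) bottomLeft-N ⟩
      det (topLeft (suc a) b (N j)) * det (bottomRight (suc a) b (N j))
        + signPow (toℕ p ℕ.+ toℕ (pinch k q)) * (det (minor (topLeft (suc a) b (N j)) p (pinch k q))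
                                                 * det (border a b (N j) p (pinch k q)))
        ≈⟨ +-cong (*-cong (det-cong-≡ (topLeft-N j)) (det-cong-≡ (bottomRight-N j)))
                  (*-congˡ (trans (*-comm _ _) (*-cong (det-cong-≡ border-N) (det-cong-≡ minor-N)))) ⟩
      det (minor A zero j) * det D + signPow (toℕ p ℕ.+ toℕ (pinch k q)) * (det W * E k) ∎
      where
      j = punchIn q k
      moved : ∀ r → punchIn (j ↑ˡ b) (punchIn (pinch k q) r ↑ˡ b) ≡ punchIn q (punchIn k r) ↑ˡ b
      moved r = ≡.trans (punchIn-↑ˡ b j (punchIn (pinch k q) r)) (cong (_↑ˡ b) (punchIn-punchIn-pinch q k r))
      bottomLeft-N : BottomLeftOnlyInColumn a b (N j) (pinch k q)
      bottomLeft-N h r = trans (reflexive (cong (M (suc (suc a ↑ʳ h))) (moved r))) (bottomLeft h (punchIn k r))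
      minor-N : ∀ r s → minor (topLeft (suc a) b (N j)) p (pinch k q) r s ≡ minor (minor A (suc p) q) zero k r s
      minor-N r s = cong (M (suc (punchIn p r ↑ˡ b))) (moved s)
      border-N : ∀ x y → border a b (N j) p (pinch k q) x y ≡ W x y
      border-N zero    zero     = refl
      border-N zero    (suc h)  = cong (M (suc (p ↑ˡ b))) (punchIn-↑ʳ b j h)
      border-N (suc h) zero     = cong (M (suc (suc a ↑ʳ h)))
                                    (≡.trans (punchIn-↑ˡ b j (pinch k q)) (cong (_↑ˡ b) (punchIn-pinch q k)))
      border-N (suc h) (suc h′) = cong (M (suc (suc a ↑ʳ h))) (punchIn-↑ʳ b j h′)

    term-q : f q ≈ laplaceTerm A q * det D
    term-q = trans (*-cong (reflexive (cong signPow (Fin.toℕ-↑ˡ q b))) (*-congˡ det-N-q))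
                   (x[y[zw]]≈[x[yz]]w _ _ _ _)

    term-punchIn : ∀ k → f (punchIn q k) ≈ laplaceTerm A (punchIn q k) * det D + Y k
    term-punchIn k = begin
      f j
        ≈⟨ *-cong (reflexive (cong signPow (Fin.toℕ-↑ˡ j b))) (*-congˡ (det-N-punchIn k)) ⟩
      σ * (A zero j * (det (minor A zero j) * det D + Z))
        ≈⟨ trans (*-congˡ (distribˡ _ _ _)) (distribˡ _ _ _) ⟩
      σ * (A zero j * (det (minor A zero j) * det D)) + σ * (A zero j * Z)
        ≈⟨ +-congʳ (x[y[zw]]≈[x[yz]]w _ _ _ _) ⟩
      laplaceTerm A j * det D + Y k ∎
      where
      j = punchIn q k
      σ = signPow (toℕ j)
      Z = signPow (toℕ p ℕ.+ toℕ (pinch k q)) * (det W * E k)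

  det-borderExpansion : ∀ a b (M : Matrix (suc a ℕ.+ b)) p q →
    TopRightOnlyInRow a b M p → BottomLeftOnlyInColumn a b M q → BorderExpansion a b M p q
  det-borderExpansion zero    b M zero    zero _        _          = borderExpansion-base b M
  det-borderExpansion (suc a) b M (suc p) q topRight bottomLeft =
    borderExpansion-step a b (det-borderExpansion a b) M p q topRight bottomLeft
  det-borderExpansion (suc a) b M zero    q topRight bottomLeft = begin
    det M
      ≈⟨ -‿involutive _ ⟨
    - - det M
      ≈⟨ -‿cong (det-swap01 M) ⟨
    - det M′
      ≈⟨ -‿cong (borderExpansion-step a b (det-borderExpansion a b) M′ zero q topRight′ bottomLeft) ⟩
    - (det A′ * det D
       + - signPow (toℕ q) * (det (minor A′ (suc zero) q) * det (border (suc a) b M′ (suc zero) q)))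
      ≈⟨ -‿cong (+-cong (*-congʳ det-A′)
                        (*-congˡ (*-cong (det-cong-≡ minor-A′) (det-cong-≡ border-M′)))) ⟩
    - (- det A * det D + - signPow (toℕ q) * (det (minor A zero q) * det (border (suc a) b M zero q)))
      ≈⟨ -‿+-comm _ _ ⟨
    - (- det A * det D) + - (- signPow (toℕ q) * (det (minor A zero q) * det (border (suc a) b M zero q)))
      ≈⟨ +-cong (-[-x*y]≈x*y _ _) (-[-x*y]≈x*y _ _) ⟩
    det A * det D + signPow (toℕ q) * (det (minor A zero q) * det (border (suc a) b M zero q)) ∎
    where
    M′ = M ∘ swap01
    A = topLeft (suc (suc a)) b M
    A′ = topLeft (suc (suc a)) b M′
    D = bottomRight (suc (suc a)) b M
    topRight′ : TopRightOnlyInRow (suc a) b M′ (suc zero)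
    topRight′ zero    h = topRight zero h
    topRight′ (suc r) h = topRight (suc r) h
    det-A′ : det A′ ≈ - det A
    det-A′ = trans (det-cong-≡ λ i j → cong (λ r → M r (j ↑ˡ b)) (swap01-↑ˡ b i)) (det-swap01 A)
    minor-A′ : ∀ r s → minor A′ (suc zero) q r s ≡ minor A zero q r s
    minor-A′ zero    s = refl
    minor-A′ (suc r) s = refl
    border-M′ : ∀ x y → border (suc a) b M′ (suc zero) q x y ≡ border (suc a) b M zero q x y
    border-M′ zero    zero    = refl
    border-M′ zero    (suc h) = refl
    border-M′ (suc h) zero    = refl
    border-M′ (suc h) (suc h′) = refl

module CharacteristicMatrix {c ℓ} (R : CommutativeRing c ℓ) (α x : CommutativeRing.Carrier R) where
  open CommutativeRing R hiding (zero; refl)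
  open RingProperties ring using (-0#≈0#; -‿+-comm)
  open Determinant R
  open SetoidReasoning setoid

  charEntry : Bool → ℕ → Bool → Carrier
  charEntry d o e =
    (if d then x else 0#) - ((if d then α * fromℕ R o else 0#) + (1# - α) * (if e then 1# else 0#))

  -- det (charMatrix G) is charPoly R α G x by unfolding.
  charMatrix : Digraph k → Matrix k
  charMatrix G i j = charEntry ⌊ i ≟ j ⌋ (outdeg G i) (arc G i j)

  charEntry-cong : ∀ {d d′ o o′ e e′} → d ≡ d′ → o ≡ o′ → e ≡ e′ →
                   charEntry d o e ≡ charEntry d′ o′ e′
  charEntry-cong refl refl refl = refl

  charEntry-zero : ∀ o → charEntry false o false ≈ 0#
  charEntry-zero o = begin
    0# - (0# + (1# - α) * 0#) ≈⟨ +-identityˡ _ ⟩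
    - (0# + (1# - α) * 0#)    ≈⟨ -‿cong (trans (+-identityˡ _) (zeroʳ _)) ⟩
    - 0#                      ≈⟨ -0#≈0# ⟩
    0#                        ∎

  fromℕ-+ : ∀ a b → fromℕ R (a ℕ.+ b) ≈ fromℕ R a + fromℕ R b
  fromℕ-+ zero    b = sym (+-identityˡ _)
  fromℕ-+ (suc a) b = trans (+-congˡ (fromℕ-+ a b)) (sym (+-assoc _ _ _))

  charEntry-+ : ∀ d o o′ e →
                charEntry d (o ℕ.+ o′) e ≈ charEntry d o e + (if d then - (α * fromℕ R o′) else 0#)
  charEntry-+ false o o′ e = sym (+-identityʳ _)
  charEntry-+ true  o o′ e = begin
    x - (α * fromℕ R (o ℕ.+ o′) + βe)
      ≈⟨ +-congˡ (-‿cong (+-congʳ (trans (*-congˡ (fromℕ-+ o o′)) (distribˡ _ _ _)))) ⟩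
    x - ((αo + αo′) + βe)
      ≈⟨ +-congˡ (-‿cong (CommutativeSemigroupProperties.xy∙z≈xz∙y +-commutativeSemigroup αo αo′ βe)) ⟩
    x - ((αo + βe) + αo′)
      ≈⟨ +-congˡ (-‿+-comm _ _) ⟨
    x + (- (αo + βe) + - αo′)
      ≈⟨ +-assoc _ _ _ ⟨
    x - (αo + βe) + - αo′ ∎
    where
    αo  = α * fromℕ R o
    αo′ = α * fromℕ R o′
    βe  = (1# - α) * (if e then 1# else 0#)

  charMatrix-≡ : (G : Digraph k) (G′ : Digraph k′) {i j : Fin k} {i′ j′ : Fin k′} →
    ⌊ i ≟ j ⌋ ≡ ⌊ i′ ≟ j′ ⌋ → outdeg G i ≡ outdeg G′ i′ → arc G i j ≡ arc G′ i′ j′ →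
    charMatrix G i j ≡ charMatrix G′ i′ j′
  charMatrix-≡ G G′ = charEntry-cong

  charMatrix-offDiagonal : (G : Digraph k) (G′ : Digraph k′) {i j : Fin k} {i′ j′ : Fin k′} →
    i ≢ j → i′ ≢ j′ → arc G i j ≡ arc G′ i′ j′ → charMatrix G i j ≡ charMatrix G′ i′ j′
  charMatrix-offDiagonal G G′ i≢j i′≢j′ arc≡ with ⌊≟⌋-≢ i≢j | ⌊≟⌋-≢ i′≢j′
  ... | d≡false | d′≡false rewrite d≡false | d′≡false | arc≡ = refl

  charMatrix-offDiagonal-≈0 : (G : Digraph k) {i j : Fin k} → i ≢ j → arc G i j ≡ false →
                              charMatrix G i j ≈ 0#
  charMatrix-offDiagonal-≈0 G {i} i≢j noArc rewrite ⌊≟⌋-≢ i≢j | noArc = charEntry-zero (outdeg G i)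

  μ : Digraph (suc k) → Fin (suc k) → Carrier
  μ G u = det (minor (charMatrix G) u u)

  gluingBorder : (H : Digraph (suc k)) → Fin (suc k) → Matrix (suc k)
  gluingBorder H w zero    zero     = 0#
  gluingBorder H w zero    (suc h)  = charMatrix H w (punchIn w h)
  gluingBorder H w (suc h) zero     = charMatrix H (punchIn w h) w
  gluingBorder H w (suc h) (suc h′) = charMatrix H (punchIn w h) (punchIn w h′)

  charPoly-coalesce : ∀ {n m} (G : Digraph (suc n)) (u : Fin (suc n)) (H : Digraph (suc m)) (w : Fin (suc m)) →
    Loopless H →
    charPoly R α (coalesce G u H w) x
      ≈ (charPoly R α G x + - (α * fromℕ R (outdeg H w)) * μ G u) * μ H w + μ G u * det (gluingBorder H w)
  charPoly-coalesce {n} {m} G u H w H-loopless = begin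
    det M
      ≈⟨ det-borderExpansion n m M u u topRight≈0 bottomLeft≈0 ⟩
    det A * det (bottomRight (suc n) m M)
      + signPow (toℕ u ℕ.+ toℕ u) * (det (minor A u u) * det (border n m M u u))
      ≈⟨ +-cong (*-cong det-A (det-cong-≡ bottomRight-M))
                (trans (*-cong (signPow-double (toℕ u)) (*-cong det-minor-A (det-cong-≡ border-M)))
                       (*-identityˡ _)) ⟩
    (det K + ζ * μ G u) * μ H w + μ G u * det (gluingBorder H w) ∎
    where
    open Coalescence G u H w H-loopless
    M = charMatrix C
    K = charMatrix G
    A = topLeft (suc n) m M
    ζ = - (α * fromℕ R (outdeg H w))

    A-punchIn : ∀ r s → A (punchIn u r) s ≡ K (punchIn u r) s
    A-punchIn r s = charMatrix-≡ C G (⌊≟⌋-injective (_↑ˡ m) (Fin.↑ˡ-injective m _ _) (punchIn u r) s)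
                                   (outdeg-G (punchIn u r) (Fin.punchInᵢ≢i u r)) (arc-G-G (punchIn u r) s)
    A-u : ∀ s → A u s ≈ K u s + δ u s ζ
    A-u s = trans (reflexive (charEntry-cong (⌊≟⌋-injective (_↑ˡ m) (Fin.↑ˡ-injective m _ _) u s)
                                             outdeg-u (arc-G-G u s)))
                  (charEntry-+ ⌊ u ≟ s ⌋ (outdeg G u) (outdeg H w) (arc G u s))
    det-A : det A ≈ det K + ζ * μ G u
    det-A = det-addDiagonal A K u ζ (λ r s → reflexive (A-punchIn r s)) A-u
    det-minor-A : det (minor A u u) ≈ μ G u
    det-minor-A = det-cong-≡ λ r s → A-punchIn r (punchIn u s)

    bottomRight-M : ∀ h h′ → bottomRight (suc n) m M h h′ ≡ minor (charMatrix H) w w h h′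
    bottomRight-M h h′ = charMatrix-≡ C H
      (≡.trans (⌊≟⌋-injective (suc n ↑ʳ_) (Fin.↑ʳ-injective (suc n) _ _) h h′)
               (≡.sym (⌊≟⌋-injective (punchIn w) (Fin.punchIn-injective w _ _) h h′)))
      (outdeg-H h) (arc-H-H h h′)
    border-M : ∀ y z → border n m M u u y z ≡ gluingBorder H w y z
    border-M zero    zero     = refl
    border-M zero    (suc h)  =
      charMatrix-offDiagonal C H (↑ˡ≢↑ʳ u h) (Fin.punchInᵢ≢i w h ∘ ≡.sym) (arc-u-H h)
    border-M (suc h) zero     =
      charMatrix-offDiagonal C H (↑ˡ≢↑ʳ u h ∘ ≡.sym) (Fin.punchInᵢ≢i w h) (arc-H-u h)
    border-M (suc h) (suc h′) = bottomRight-M h h′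

    topRight≈0 : TopRightOnlyInRow n m M u
    topRight≈0 r h = charMatrix-offDiagonal-≈0 C (↑ˡ≢↑ʳ (punchIn u r) h)
                                               (arc-G-H (punchIn u r) h (Fin.punchInᵢ≢i u r))
    bottomLeft≈0 : BottomLeftOnlyInColumn n m M u
    bottomLeft≈0 h r = charMatrix-offDiagonal-≈0 C (↑ˡ≢↑ʳ (punchIn u r) h ∘ ≡.sym)
                                                 (arc-H-G h (punchIn u r) (Fin.punchInᵢ≢i u r))

  μ-arc-punchIn : (G : Digraph (suc (suc k))) → Loopless G → (u : Fin (suc (suc k))) (c : Fin (suc k)) →
    arc G u (punchIn u c) ≡ true → outdeg G u ≡ 1 → outdeg G (punchIn u c) ≡ 1 → indeg G (punchIn u c) ≡ 1 →
    μ G u ≈ μ G (punchIn u c)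
  μ-arc-punchIn G loopless u c u→v outdeg-u outdeg-v indeg-v = begin
    det (minor K u u)
      ≈⟨ det-singleColumn (minor K u u) c c column≈0 ⟩
    signPow (toℕ c ℕ.+ toℕ c) * (K v v * det (minor (minor K u u) c c))
      ≈⟨ *-cong (trans (signPow-double (toℕ c)) (sym (signPow-double (toℕ d))))
                (*-cong (reflexive K-vv≡K-uu)
                        (det-cong-≡ λ r s → cong₂ K (≡.sym (moved r)) (≡.sym (moved s)))) ⟩
    signPow (toℕ d ℕ.+ toℕ d) * (minor K v v d d * det (minor (minor K v v) d d))
      ≈⟨ det-singleRow (minor K v v) d d row≈0 ⟨
    det (minor K v v) ∎
    where
    K = charMatrix G
    v = punchIn u c
    d = pinch c u
    u≡ : punchIn v d ≡ u
    u≡ = punchIn-pinch u c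
    moved : ∀ r → punchIn v (punchIn d r) ≡ punchIn u (punchIn c r)
    moved = punchIn-punchIn-pinch u c
    K-vv≡K-uu : K v v ≡ K (punchIn v d) (punchIn v d)
    K-vv≡K-uu = ≡.trans (charMatrix-≡ G G (≡.trans (⌊≟⌋-refl v) (≡.sym (⌊≟⌋-refl u)))
                                          (≡.trans outdeg-v (≡.sym outdeg-u))
                                          (≡.trans (loopless v) (≡.sym (loopless u))))
                        (cong₂ K (≡.sym u≡) (≡.sym u≡))
    column≈0 : ∀ l → minor K u u (punchIn c l) c ≈ 0#
    column≈0 l = charMatrix-offDiagonal-≈0 G
      (Fin.punchInᵢ≢i c l ∘ Fin.punchIn-injective u _ _)
      (count≡1⇒unique (λ j → arc G j v) u indeg-v u→v (punchIn c l))
    row≈0 : ∀ l → minor K v v d (punchIn d l) ≈ 0#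
    row≈0 l = trans (reflexive (cong (λ r → K r (punchIn v (punchIn d l))) u≡))
      (charMatrix-offDiagonal-≈0 G
        (λ u≡v′ → Fin.punchInᵢ≢i d l
                    (Fin.punchIn-injective v _ _ (≡.trans (≡.sym u≡v′) (≡.sym u≡))))
        (count≡1⇒unique (arc G u) v outdeg-u u→v (punchIn d l)))

  μ-arc : (G : Digraph (suc k)) → Loopless G → (u v : Fin (suc k)) → u ≢ v → arc G u v ≡ true →
          outdeg G u ≡ 1 → outdeg G v ≡ 1 → indeg G v ≡ 1 → μ G u ≈ μ G v
  μ-arc {zero}  G loopless zero zero u≢v = ⊥-elim (u≢v refl)
  μ-arc {suc k} G loopless u v u≢v rewrite ≡.sym (Fin.punchIn-punchOut u≢v) =
    μ-arc-punchIn G loopless u (Fin.punchOut u≢v)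

  module _ (G : Digraph (suc k)) (loopless : Loopless G) (P : InternalPath G) where

    μ-consecutive : ∀ (i : Fin (len P)) → 0 ℕ.< toℕ i → suc (toℕ i) ℕ.< len P →
                    μ G (vtx P (Fin.inject₁ i)) ≈ μ G (vtx P (suc i))
    μ-consecutive i 0<i i+1<len = μ-arc G loopless _ _ consecutive-distinct (arcs P i)
      (proj₂ (internalDeg P (Fin.inject₁ i) (≡.subst (0 ℕ.<_) (≡.sym toℕ-i) 0<i)
                                            (≡.subst (ℕ._< len P) (≡.sym toℕ-i) (Fin.toℕ<n i))))
      (proj₂ deg-next) (proj₁ deg-next)
      where
      toℕ-i : toℕ (Fin.inject₁ i) ≡ toℕ i
      toℕ-i = Fin.toℕ-inject₁ i
      deg-next : (indeg G (vtx P (suc i)) ≡ 1) × (outdeg G (vtx P (suc i)) ≡ 1)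
      deg-next = internalDeg P (suc i) (ℕ.s≤s ℕ.z≤n) i+1<len
      consecutive-distinct : vtx P (Fin.inject₁ i) ≢ vtx P (suc i)
      consecutive-distinct eq = ℕ.1+n≢n (≡.sym (≡.trans (≡.sym toℕ-i) (cong toℕ (distinct P eq))))

    μ-internal : ∀ {u v} → IsInternalVertexOf P u → IsInternalVertexOf P v → μ G u ≈ μ G v
    μ-internal (i , 0<i , i<len , refl) (j , 0<j , j<len , refl) =
      trans (μ-fromOne _ i (toℕ-suc 0<i) i<len) (sym (μ-fromOne _ j (toℕ-suc 0<j) j<len))
      where
      toℕ-suc : ∀ {t} → 0 ℕ.< t → t ≡ suc (ℕ.pred t)
      toℕ-suc (ℕ.s≤s ℕ.z≤n) = refl
      1<1+len : 1 ℕ.< suc (len P)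
      1<1+len = ℕ.s≤s (ℕ.≤-trans 0<i (ℕ.<⇒≤ i<len))
      one : Fin (suc (len P))
      one = Fin.fromℕ< 1<1+len
      μ-fromOne : ∀ t (i : Fin (suc (len P))) → toℕ i ≡ suc t → toℕ i ℕ.< len P →
                  μ G (vtx P i) ≈ μ G (vtx P one)
      μ-fromOne zero    i       i≡1   _     =
        reflexive (cong (μ G ∘ vtx P) (Fin.toℕ-injective (≡.trans i≡1 (≡.sym (Fin.toℕ-fromℕ< 1<1+len)))))
      μ-fromOne (suc t) (suc i) i≡t+2 i<len = trans
        (sym (μ-consecutive i (≡.subst (0 ℕ.<_) (≡.sym (ℕ.suc-injective i≡t+2)) (ℕ.s≤s ℕ.z≤n)) i<len))
        (μ-fromOne t (Fin.inject₁ i) (≡.trans (Fin.toℕ-inject₁ i) (ℕ.suc-injective i≡t+2))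
                   (≡.subst (ℕ._< len P) (≡.sym (Fin.toℕ-inject₁ i)) (Fin.toℕ<n i)))

lemma2p9 : ∀ {c ℓ : Level} (R : CommutativeRing c ℓ) (α x : CommutativeRing.Carrier R)
             {n m : ℕ} (G : Digraph n) (H : Digraph (suc m)) (w : Fin (suc m)) (u v : Fin n) →
             Loopless G → Loopless H →
             (P : InternalPath G) → IsInternalVertexOf P u → IsInternalVertexOf P v →
             CommutativeRing._≈_ R (charPoly R α (coalesce G u H w) x) (charPoly R α (coalesce G v H w) x)
lemma2p9 R α x {zero}  G H w () v
lemma2p9 R α x {suc n} G H w u v G-loopless H-loopless P u∈P v∈P = begin
  charPoly R α (coalesce G u H w) x
    ≈⟨ charPoly-coalesce G u H w H-loopless ⟩
  (charPoly R α G x + ζ * μ G u) * μ H w + μ G u * det (gluingBorder H w)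
    ≈⟨ +-cong (*-congʳ (+-congˡ (*-congˡ μu≈μv))) (*-congʳ μu≈μv) ⟩
  (charPoly R α G x + ζ * μ G v) * μ H w + μ G v * det (gluingBorder H w)
    ≈⟨ charPoly-coalesce G v H w H-loopless ⟨
  charPoly R α (coalesce G v H w) x ∎
  where
  open CommutativeRing R hiding (zero; refl)
  open Determinant R using (det)
  open CharacteristicMatrix R α x
  open SetoidReasoning setoid
  ζ : Carrier
  ζ = - (α * fromℕ R (outdeg H w))
  μu≈μv : μ G u ≈ μ G v
  μu≈μv = μ-internal G G-loopless P u∈P v∈P
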